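{- Let $k$ and $n\geq 3$ be integers. Let $\mathbf{x}=(x_1,\dots,x_n)\in\mathfrak{T}_1'(1,k,n)$ with $x_1=1$, so that $x_1=\cdots=x_{n-2}=1\leq x_{n-1}\leq x_n$. Then exactly one of the following holds. (i) $x_{n-1}=x_n$, and $\mathbf{x}$ has a descendent vertex $\mathbf{y}=(0,1,\dots,1,x_{n-1})$, which lies in $\mathfrak{T}_0'(1,k,n)$. (ii) $x_{n-1}<x_n$, and $\mathbf{x}$ has a descendent vertex $\mathbf{y}=(-1,1,\dots,1,x_n-x_{n-1},x_{n-1})$, which lies in $\mathfrak{T}_1'(1,k,n)$. Moreover, in either case $\mathbf{y}\sim\mathcal{V}_{1,n,n}(\mathbf{x})$, and $\mathbf{y}$ is a descendent vertex of each of $\mathbf{x},\mathcal{V}_{1,n,1}(\mathbf{x}),\dots,\mathcal{V}_{1,n,n}(\mathbf{x})$.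
   Context: $V_{1,k,n}(\mathbb{Z})$ is the set of integer solutions $(x_1,\dots,x_n)\in\mathbb{Z}^n$ of $x_1^2+\cdots+x_n^2-x_1\cdots x_n=k$. For $i=1,\dots,n$, the Vieta involution is $\mathcal{V}_{1,n,i}(x_1,\dots,x_n)=(x_1,\dots,x_{i-1},\,x_1\cdots x_{i-1}x_{i+1}\cdots x_n-x_i,\,x_{i+1},\dots,x_n)$; it preserves $V_{1,k,n}(\mathbb{Z})$. Write $\mathbf{x}\sim\mathbf{y}$ if $\mathbf{y}$ is obtained from $\mathbf{x}$ by a finite sequence of coordinate permutations and double sign changes (negating two coordinates simultaneously). The height is $\Delta(x_1,\dots,x_n)=|x_1|+\cdots+|x_n|$. For $s\in\{0,1\}$, let $\mathfrak{T}_s'(1,k,n)=\{\mathbf{x}\in V_{1,k,n}(\mathbb{Z}):\ 0\leq|x_1|\leq x_2\leq\cdots\leq x_n,\ |x_1\cdots x_{n-2}|=s\}$. For $\mathbf{u},\mathbf{v}\in V_{1,k,n}(\mathbb{Z})$, $\mathbf{u}$ is a descendent vertex of $\mathbf{v}$ (equivalently, $\mathbf{v}$ has descendent vertex $\mathbf{u}$) if there exist $N\geq 0$ and indices $l_1,\dots,l_N\in\{1,\dots,n\}$ such that, writing $\mathbf{z}_0=\mathbf{u}$ and $\mathbf{z}_t=\mathcal{V}_{1,n,l_t}(\mathbf{z}_{t-1})$, we have $\mathbf{v}\sim\mathbf{z}_N$ and $\Delta(\mathbf{z}_0)\leq\Delta(\mathbf{z}_1)\leq\cdots\leq\Delta(\mathbf{z}_N)$.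 Since $\sim$ is compatible with the involutions and $\Delta$ is $\sim$-invariant, this notion depends only on the $\sim$-classes of $\mathbf{u}$ and $\mathbf{v}$. -}

module Defs where

open import Data.Nat using (ℕ; zero; suc; _∸_)
import Data.Nat
open import Data.Integer using (ℤ; +_; -_; _+_; _-_; _*_; _≤_; ∣_∣)
open import Data.Fin using (Fin; zero; suc)
import Data.Fin as Fin
open import Data.Fin.Permutation using (Permutation′; _⟨$⟩ʳ_)
open import Data.Vec using (Vec; []; _∷_; lookup; tabulate; updateAt; _[_]≔_)
open import Data.Product using (Σ; ∃; _×_; _,_)
open import Relation.Binary.PropositionalEquality using (_≡_; _≢_)
open import Relation.Binary.Construct.Closure.ReflexiveTransitive using (Star)

sumℤ : ∀ {n} → Vec ℤ n → ℤ
sumℤ []       = + 0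
sumℤ (x ∷ xs) = x + sumℤ xs

prodℤ : ∀ {n} → Vec ℤ n → ℤ
prodℤ []       = + 1
prodℤ (x ∷ xs) = x * prodℤ xs

sumSq : ∀ {n} → Vec ℤ n → ℤ
sumSq []       = + 0
sumSq (x ∷ xs) = x * x + sumSq xs

prodExcept : ∀ {n} → Fin n → Vec ℤ n → ℤ
prodExcept zero    (x ∷ xs) = prodℤ xs
prodExcept (suc i) (x ∷ xs) = x * prodExcept i xs

prodPrefix : ∀ {n} → ℕ → Vec ℤ n → ℤ
prodPrefix zero    _        = + 1
prodPrefix (suc j) []       = + 1
prodPrefix (suc j) (x ∷ xs) = x * prodPrefix j xs

InV : ∀ {n} → ℤ → Vec ℤ n → Set
InV k x = sumSq x - prodℤ x ≡ k

-- Vieta involution 𝒱_{1,n,i} (index i is 0-based Fin n)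
vieta : ∀ {n} → Fin n → Vec ℤ n → Vec ℤ n
vieta i x = x [ i ]≔ (prodExcept i x - lookup x i)

height : ∀ {n} → Vec ℤ n → ℕ
height []       = 0
height (x ∷ xs) = ∣ x ∣ Data.Nat.+ height xs

data Step {n : ℕ} : Vec ℤ n → Vec ℤ n → Set where
  perm    : (π : Permutation′ n) (x : Vec ℤ n) →
            Step x (tabulate (λ j → lookup x (π ⟨$⟩ʳ j)))
  dblSign : (i j : Fin n) → i ≢ j → (x : Vec ℤ n) →
            Step x (updateAt (updateAt x i (λ t → - t)) j (λ t → - t))

_∼_ : ∀ {n} → Vec ℤ n → Vec ℤ n → Set
_∼_ = Star Step

data Chain {n : ℕ} : Vec ℤ n → Vec ℤ n → Set where
  done : (u : Vec ℤ n) → Chain u u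
  step : (u : Vec ℤ n) (l : Fin n) {z : Vec ℤ n} →
         height u Data.Nat.≤ height (vieta l u) → Chain (vieta l u) z → Chain u z

DescendentOf : ∀ {n} → Vec ℤ n → Vec ℤ n → Set
DescendentOf u v = ∃ λ z → Chain u z × (v ∼ z)

-- 0 ≤ |x_1| ≤ x_2 ≤ ⋯ ≤ x_n  (first coordinate replaced by its absolute value, then ascending)
absHead : ∀ {n} → Vec ℤ n → Vec ℤ n
absHead []       = []
absHead (x ∷ xs) = + ∣ x ∣ ∷ xs

Ordered : ∀ {n} → Vec ℤ n → Set
Ordered {n} x = (i j : Fin n) → i Fin.≤ j → lookup (absHead x) i ≤ lookup (absHead x) j

InT' : ∀ {n} → ℕ → ℤ → Vec ℤ n → Set
InT' {n} s k x = InV k x × Ordered x × (∣ prodPrefix (n ∸ 2) x ∣ ≡ s)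

onesThen : (j : ℕ) → ℤ → ℤ → Vec ℤ (suc (suc j))
onesThen zero    a b = a ∷ b ∷ []
onesThen (suc j) a b = + 1 ∷ onesThen j a b

{-# OPTIONS --safe #-}
-- Apart from the images of x under the Vieta moves at its coordinates equal to 1, which are all
-- conjugate to 𝒱₁(x) by transpositions, every vector in the argument has the shape
-- (h, 1, …, 1, c, d).  There a Vieta move at h, c or d replaces that entry by the product of the
-- other two minus itself, and the moves of ∼ needed only swap or negate h, c, d, so every equality
-- is a ring identity in h, c, d.  If a = b, an upward move takes y = (0, 1, …, 1, a) to
-- (a, 1, …, 1, 1, a) ∼ x; if a < b, one takes y = (−1, 1, …, 1, b − a, a) to
-- (−1, 1, …, 1, −b, a) ∼ x.  Each 𝒱ᵢ(x) is ∼ to the end of at most two upward moves from y; the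
-- only non-trivial height bound is |a·b − 1| ≥ 1 for a ≥ 1, b ≥ 2.
module Submission where

open import Defs
open import Data.Nat using (ℕ; suc)
open import Data.Integer using (ℤ; +_; -_; _-_; _<_)
open import Data.Fin using (Fin; zero; fromℕ; inject₁)
open import Data.Vec using (Vec; lookup; _∷_)
open import Data.Product using (∃; _×_)
open import Data.Sum using (_⊎_)
open import Relation.Nullary using (¬_)
open import Relation.Binary.PropositionalEquality using (_≡_)

import Data.Nat as ℕ
import Data.Nat.Properties as ℕₚ
open import Data.Integer using (_+_; _*_; _≤_; ∣_∣; 0ℤ; 1ℤ; -1ℤ; +≤+; +<+)
import Data.Integer.Properties as ℤₚ
open import Data.Integer.Tactic.RingSolver using (solve-∀)
open import Data.Fin using (suc)
import Data.Fin as Fin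
import Data.Fin.Properties as Finₚ
open import Data.Fin.Permutation using (transpose; _⟨$⟩ʳ_)
open import Data.Vec using ([]; updateAt; _[_]≔_)
open import Data.Vec.Properties
  using (lookup∘update; lookup∘update′; []≔-idempotent; []≔-lookup; tabulate-cong; tabulate∘lookup)
open import Data.Product using (_,_)
open import Data.Sum using (inj₁; inj₂)
open import Function using (_∘′_)
open import Relation.Nullary using (yes; no; contradiction)
open import Relation.Binary.PropositionalEquality using (refl; sym; trans; cong; cong₂; subst; _≢_)
open import Relation.Binary.Construct.Closure.ReflexiveTransitive using (ε; _◅_; _◅◅_)
open import Algebra.Properties.CommutativeSemigroup ℤₚ.*-commutativeSemigroup using (x∙yz≈y∙xz)

transpose-step : ∀ {n} (i j : Fin n) → i ≢ j → (x : Vec ℤ n) →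
                 Step x ((x [ i ]≔ lookup x j) [ j ]≔ lookup x i)
transpose-step i j i≢j x =
  subst (Step x) (trans (tabulate-cong lookup-transpose) (tabulate∘lookup _)) (perm (transpose i j) x)
  where
  x′ = x [ i ]≔ lookup x j
  lookup-transpose : ∀ l → lookup x (transpose i j ⟨$⟩ʳ l) ≡ lookup (x′ [ j ]≔ lookup x i) l
  lookup-transpose l with l Finₚ.≟ i
  ... | yes refl = sym (trans (lookup∘update′ i≢j x′ (lookup x i)) (lookup∘update i x (lookup x j)))
  ... | no l≢i with l Finₚ.≟ j
  ...   | yes refl = sym (lookup∘update j x′ (lookup x i))
  ...   | no l≢j   = sym (trans (lookup∘update′ l≢j x′ (lookup x i)) (lookup∘update′ l≢i x (lookup x j)))

prodℤ≡lookup*prodExcept : ∀ {n} (x : Vec ℤ n) i → prodℤ x ≡ lookup x i * prodExcept i x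
prodℤ≡lookup*prodExcept (p ∷ x) zero    = refl
prodℤ≡lookup*prodExcept (p ∷ x) (suc i) =
  trans (cong (p *_) (prodℤ≡lookup*prodExcept x i)) (x∙yz≈y∙xz p (lookup x i) (prodExcept i x))

vieta-at-equal-coordinates : ∀ {n} {p} (w : Vec ℤ n) i → lookup w i ≡ p →
                             Step (vieta (suc i) (p ∷ w)) (vieta zero (p ∷ w))
vieta-at-equal-coordinates w i refl =
  subst (Step _) (cong₂ _∷_ new-head new-tail) (transpose-step zero (suc i) (λ ()) _)
  where
  p = lookup w i
  e = p * prodExcept i w - p
  new-head : lookup (w [ i ]≔ e) i ≡ prodℤ w - p
  new-head = trans (lookup∘update i w e) (cong (_- p) (sym (prodℤ≡lookup*prodExcept w i)))
  new-tail : (w [ i ]≔ e) [ i ]≔ p ≡ w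
  new-tail = trans ([]≔-idempotent w i) ([]≔-lookup w i)

≡⇒∼ : ∀ {n} {x y : Vec ℤ n} → x ≡ y → x ∼ y
≡⇒∼ refl = ε

descendent-resp-∼ : ∀ {n} {u v v′ : Vec ℤ n} → DescendentOf u v → v′ ∼ v → DescendentOf u v′
descendent-resp-∼ (z , chain , v∼z) v′∼v = z , chain , v′∼v ◅◅ v∼z

penultimate : ∀ {m} → Fin (2 ℕ.+ m)
penultimate {m} = inject₁ (fromℕ m)

ultimate : ∀ {m} → Fin (2 ℕ.+ m)
ultimate {m} = fromℕ (suc m)

penultimate≤ultimate : ∀ {m} → penultimate {m} Fin.≤ ultimate {m}
penultimate≤ultimate {ℕ.zero} = ℕ.z≤n
penultimate≤ultimate {suc m}  = ℕ.s≤s (penultimate≤ultimate {m})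

data OnesThenPosition (m : ℕ) : Fin (2 ℕ.+ m) → Set where
  at-one         : (j : Fin m) → OnesThenPosition m (inject₁ (inject₁ j))
  at-penultimate : OnesThenPosition m penultimate
  at-ultimate    : OnesThenPosition m ultimate

onesThenPosition : ∀ {m} (i : Fin (2 ℕ.+ m)) → OnesThenPosition m i
onesThenPosition {ℕ.zero} zero       = at-penultimate
onesThenPosition {ℕ.zero} (suc zero) = at-ultimate
onesThenPosition {suc m}  zero       = at-one zero
onesThenPosition {suc m}  (suc i) with onesThenPosition i
... | at-one j       = at-one (suc j)
... | at-penultimate = at-penultimate
... | at-ultimate    = at-ultimate

lookup-onesThen-one : ∀ {m} c d (j : Fin m) → lookup (onesThen m c d) (inject₁ (inject₁ j)) ≡ 1ℤ
lookup-onesThen-one {suc m} c d zero    = refl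
lookup-onesThen-one {suc m} c d (suc j) = lookup-onesThen-one c d j

lookup-onesThen-penultimate : ∀ m c d → lookup (onesThen m c d) penultimate ≡ c
lookup-onesThen-penultimate ℕ.zero  c d = refl
lookup-onesThen-penultimate (suc m) c d = lookup-onesThen-penultimate m c d

lookup-onesThen-ultimate : ∀ m c d → lookup (onesThen m c d) ultimate ≡ d
lookup-onesThen-ultimate ℕ.zero  c d = refl
lookup-onesThen-ultimate (suc m) c d = lookup-onesThen-ultimate m c d

updateAt-onesThen-penultimate : ∀ m c d f →
                                updateAt (onesThen m c d) penultimate f ≡ onesThen m (f c) d
updateAt-onesThen-penultimate ℕ.zero  c d f = refl
updateAt-onesThen-penultimate (suc m) c d f = cong (1ℤ ∷_) (updateAt-onesThen-penultimate m c d f)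

updateAt-onesThen-ultimate : ∀ m c d f → updateAt (onesThen m c d) ultimate f ≡ onesThen m c (f d)
updateAt-onesThen-ultimate ℕ.zero  c d f = refl
updateAt-onesThen-ultimate (suc m) c d f = cong (1ℤ ∷_) (updateAt-onesThen-ultimate m c d f)

prodℤ-onesThen : ∀ m c d → prodℤ (onesThen m c d) ≡ c * d
prodℤ-onesThen ℕ.zero  c d = cong (c *_) (ℤₚ.*-identityʳ d)
prodℤ-onesThen (suc m) c d = trans (ℤₚ.*-identityˡ _) (prodℤ-onesThen m c d)

prodExcept-onesThen-penultimate : ∀ m c d → prodExcept penultimate (onesThen m c d) ≡ d
prodExcept-onesThen-penultimate ℕ.zero  c d = ℤₚ.*-identityʳ d
prodExcept-onesThen-penultimate (suc m) c d =
  trans (ℤₚ.*-identityˡ _) (prodExcept-onesThen-penultimate m c d)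

prodExcept-onesThen-ultimate : ∀ m c d → prodExcept ultimate (onesThen m c d) ≡ c
prodExcept-onesThen-ultimate ℕ.zero  c d = ℤₚ.*-identityʳ c
prodExcept-onesThen-ultimate (suc m) c d =
  trans (ℤₚ.*-identityˡ _) (prodExcept-onesThen-ultimate m c d)

prodPrefix-onesThen : ∀ m c d → prodPrefix m (onesThen m c d) ≡ 1ℤ
prodPrefix-onesThen ℕ.zero  c d = refl
prodPrefix-onesThen (suc m) c d = trans (ℤₚ.*-identityˡ _) (prodPrefix-onesThen m c d)

sumSq-onesThen : ∀ m c d → sumSq (onesThen m c d) ≡ + m + (c * c + d * d)
sumSq-onesThen ℕ.zero  c d =
  trans (cong (λ s → c * c + s) (ℤₚ.+-identityʳ (d * d))) (sym (ℤₚ.+-identityˡ _))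
sumSq-onesThen (suc m) c d =
  trans (cong (λ s → 1ℤ + s) (sumSq-onesThen m c d)) (sym (ℤₚ.+-assoc 1ℤ (+ m) (c * c + d * d)))

height-onesThen-mono : ∀ m {c d c′ d′} → ∣ c ∣ ℕ.≤ ∣ c′ ∣ → ∣ d ∣ ℕ.≤ ∣ d′ ∣ →
                       height (onesThen m c d) ℕ.≤ height (onesThen m c′ d′)
height-onesThen-mono ℕ.zero  c≤c′ d≤d′ = ℕₚ.+-mono-≤ c≤c′ (ℕₚ.+-mono-≤ d≤d′ ℕₚ.≤-refl)
height-onesThen-mono (suc m) c≤c′ d≤d′ = ℕ.s≤s (height-onesThen-mono m c≤c′ d≤d′)

1≤i⇒∣i∣≡1⇒i≡1 : ∀ {i} → 1ℤ ≤ i → ∣ i ∣ ≡ 1 → i ≡ 1ℤ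
1≤i⇒∣i∣≡1⇒i≡1 (+≤+ _) refl = refl

unitPrefix⇒≡onesThen : ∀ m (w : Vec ℤ (2 ℕ.+ m)) → (∀ i → 1ℤ ≤ lookup w i) → ∣ prodPrefix m w ∣ ≡ 1 →
                       w ≡ onesThen m (lookup w penultimate) (lookup w ultimate)
unitPrefix⇒≡onesThen ℕ.zero  (c ∷ d ∷ []) _ _ = refl
unitPrefix⇒≡onesThen (suc m) (p ∷ w) 1≤w ∣p*q∣≡1 =
  cong₂ _∷_ (1≤i⇒∣i∣≡1⇒i≡1 (1≤w zero) (ℕₚ.m*n≡1⇒m≡1 ∣ p ∣ _ ∣p∣*∣q∣≡1))
            (unitPrefix⇒≡onesThen m w (λ i → 1≤w (suc i)) (ℕₚ.m*n≡1⇒n≡1 ∣ p ∣ _ ∣p∣*∣q∣≡1))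
  where
  ∣p∣*∣q∣≡1 = trans (sym (ℤₚ.abs-* p (prodPrefix m w))) ∣p*q∣≡1

NonDecreasing : ∀ {n} → Vec ℤ n → Set
NonDecreasing {n} v = (i j : Fin n) → i Fin.≤ j → lookup v i ≤ lookup v j

∷-nonDecreasing : ∀ {n h} {v : Vec ℤ n} →
                  (∀ i → h ≤ lookup v i) → NonDecreasing v → NonDecreasing (h ∷ v)
∷-nonDecreasing _   _  zero    zero    _           = ℤₚ.≤-refl
∷-nonDecreasing h≤v _  zero    (suc j) _           = h≤v j
∷-nonDecreasing _   v↑ (suc i) (suc j) (ℕ.s≤s i≤j) = v↑ i j i≤j

onesThen-≥1 : ∀ m {c d} → 1ℤ ≤ c → c ≤ d → ∀ i → 1ℤ ≤ lookup (onesThen m c d) i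
onesThen-≥1 ℕ.zero  1≤c c≤d zero       = 1≤c
onesThen-≥1 ℕ.zero  1≤c c≤d (suc zero) = ℤₚ.≤-trans 1≤c c≤d
onesThen-≥1 (suc m) 1≤c c≤d zero       = ℤₚ.≤-refl
onesThen-≥1 (suc m) 1≤c c≤d (suc i)    = onesThen-≥1 m 1≤c c≤d i

onesThen-nonDecreasing : ∀ m {c d} → 1ℤ ≤ c → c ≤ d → NonDecreasing (onesThen m c d)
onesThen-nonDecreasing ℕ.zero  1≤c c≤d =
  ∷-nonDecreasing (λ { zero → c≤d ; (suc ()) }) (∷-nonDecreasing (λ ()) (λ ()))
onesThen-nonDecreasing (suc m) 1≤c c≤d =
  ∷-nonDecreasing (onesThen-≥1 m 1≤c c≤d) (onesThen-nonDecreasing m 1≤c c≤d)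

vieta-head : ∀ m h c d → vieta zero (h ∷ onesThen m c d) ≡ (c * d - h) ∷ onesThen m c d
vieta-head m h c d = cong (λ p → p - h ∷ onesThen m c d) (prodℤ-onesThen m c d)

vieta-penultimate : ∀ m h c d →
                    vieta (suc penultimate) (h ∷ onesThen m c d) ≡ h ∷ onesThen m (h * d - c) d
vieta-penultimate m h c d
  rewrite prodExcept-onesThen-penultimate m c d | lookup-onesThen-penultimate m c d =
  cong (h ∷_) (updateAt-onesThen-penultimate m c d _)

vieta-ultimate : ∀ m h c d → vieta (suc ultimate) (h ∷ onesThen m c d) ≡ h ∷ onesThen m c (h * c - d)
vieta-ultimate m h c d
  rewrite prodExcept-onesThen-ultimate m c d | lookup-onesThen-ultimate m c d =
  cong (h ∷_) (updateAt-onesThen-ultimate m c d _)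

vieta-step : ∀ m {h c d h′ c′ d′ z} (l : Fin (3 ℕ.+ m)) →
             vieta l (h ∷ onesThen m c d) ≡ h′ ∷ onesThen m c′ d′ →
             ∣ h ∣ ℕ.≤ ∣ h′ ∣ → ∣ c ∣ ℕ.≤ ∣ c′ ∣ → ∣ d ∣ ℕ.≤ ∣ d′ ∣ →
             Chain (h′ ∷ onesThen m c′ d′) z → Chain (h ∷ onesThen m c d) z
vieta-step m {h} {c} {d} {z = z} l eq h≤h′ c≤c′ d≤d′ chain =
  step _ l (subst (λ v → height (h ∷ onesThen m c d) ℕ.≤ height v) (sym eq) higher)
           (subst (λ v → Chain v z) (sym eq) chain)
  where
  higher = ℕₚ.+-mono-≤ h≤h′ (height-onesThen-mono m c≤c′ d≤d′)

swap-head-penultimate : ∀ m h c d → Step (h ∷ onesThen m c d) (c ∷ onesThen m h d)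
swap-head-penultimate m h c d =
  subst (Step _)
        (cong₂ _∷_ (lookup-onesThen-penultimate m c d) (updateAt-onesThen-penultimate m c d _))
        (transpose-step zero (suc penultimate) (λ ()) _)

swap-penultimate-ultimate : ∀ m h c d → Step (h ∷ onesThen m c d) (h ∷ onesThen m d c)
swap-penultimate-ultimate m h c d =
  subst (Step _) (cong (h ∷_) swapped) (transpose-step (suc penultimate) (suc ultimate) P≢U _)
  where
  w = onesThen m c d
  P≢U = Finₚ.fromℕ≢inject₁ ∘′ sym ∘′ Finₚ.suc-injective
  swapped : (w [ penultimate ]≔ lookup w ultimate) [ ultimate ]≔ lookup w penultimate ≡ onesThen m d c
  swapped rewrite lookup-onesThen-ultimate m c d | lookup-onesThen-penultimate m c d
                | updateAt-onesThen-penultimate m c d (λ _ → d) = updateAt-onesThen-ultimate m d d _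

negate-head-penultimate : ∀ m h c d → Step (h ∷ onesThen m c d) (- h ∷ onesThen m (- c) d)
negate-head-penultimate m h c d =
  subst (Step _) (cong (- h ∷_) (updateAt-onesThen-penultimate m c d (-_)))
        (dblSign zero (suc penultimate) (λ ()) _)

negate-head-ultimate : ∀ m h c d → Step (h ∷ onesThen m c d) (- h ∷ onesThen m c (- d))
negate-head-ultimate m h c d =
  subst (Step _) (cong (- h ∷_) (updateAt-onesThen-ultimate m c d (-_)))
        (dblSign zero (suc ultimate) (λ ()) _)

descendent-of-vietas : ∀ {m} {y : Vec ℤ (3 ℕ.+ m)} c d →
  DescendentOf y (vieta zero (1ℤ ∷ onesThen m c d)) →
  DescendentOf y (vieta (suc penultimate) (1ℤ ∷ onesThen m c d)) →
  DescendentOf y (vieta (suc ultimate) (1ℤ ∷ onesThen m c d)) →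
  ∀ i → DescendentOf y (vieta i (1ℤ ∷ onesThen m c d))
descendent-of-vietas c d from-head _ _ zero = from-head
descendent-of-vietas c d from-head from-penultimate from-ultimate (suc i) with onesThenPosition i
... | at-one j       =
  descendent-resp-∼ from-head (vieta-at-equal-coordinates _ _ (lookup-onesThen-one c d j) ◅ ε)
... | at-penultimate = from-penultimate
... | at-ultimate    = from-ultimate

markoff : ℕ → ℤ → ℤ → ℤ → ℤ
markoff m h c d = h * h + (+ m + (c * c + d * d)) - h * (c * d)

sumSq-prodℤ≡markoff : ∀ m h c d →
                      sumSq (h ∷ onesThen m c d) - prodℤ (h ∷ onesThen m c d) ≡ markoff m h c d
sumSq-prodℤ≡markoff m h c d =
  cong₂ (λ s p → h * h + s - h * p) (sumSq-onesThen m c d) (prodℤ-onesThen m c d)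

InV-transfer : ∀ {k} m h c d h′ c′ d′ → markoff m h c d ≡ markoff m h′ c′ d′ →
               InV k (h ∷ onesThen m c d) → InV k (h′ ∷ onesThen m c′ d′)
InV-transfer m h c d h′ c′ d′ eq x∈V =
  trans (sumSq-prodℤ≡markoff m h′ c′ d′)
        (trans (sym eq) (trans (sym (sumSq-prodℤ≡markoff m h c d)) x∈V))

markoff-swap : ∀ m h c d → markoff m h c d ≡ markoff m h d c
markoff-swap m h c d =
  cong₂ (λ s p → h * h + (+ m + s) - h * p) (ℤₚ.+-comm (c * c) (d * d)) (ℤₚ.*-comm c d)

∷onesThen∈T′ : ∀ {k} m h c d → InV k (h ∷ onesThen m c d) → ∣ h ∣ ℕ.≤ 1 → 1ℤ ≤ c → c ≤ d →
               InT' ∣ h ∣ k (h ∷ onesThen m c d)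
∷onesThen∈T′ m h c d x∈V ∣h∣≤1 1≤c c≤d =
  x∈V ,
  ∷-nonDecreasing (λ i → ℤₚ.≤-trans (+≤+ ∣h∣≤1) (onesThen-≥1 m 1≤c c≤d i))
                  (onesThen-nonDecreasing m 1≤c c≤d) ,
  cong ∣_∣ (trans (cong (h *_) (prodPrefix-onesThen m c d)) (ℤₚ.*-identityʳ h))

sort-∷onesThen : ∀ {k} m h c d → InV k (h ∷ onesThen m c d) → ∣ h ∣ ℕ.≤ 1 → 1ℤ ≤ c → 1ℤ ≤ d →
                 ∃ λ z → ((h ∷ onesThen m c d) ∼ z) × InT' ∣ h ∣ k z
sort-∷onesThen m h c d x∈V ∣h∣≤1 1≤c 1≤d with ℤₚ.≤-total c d
... | inj₁ c≤d = _ , ε , ∷onesThen∈T′ m h c d x∈V ∣h∣≤1 1≤c c≤d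
... | inj₂ d≤c = _ , swap-penultimate-ultimate m h c d ◅ ε ,
                 ∷onesThen∈T′ m h d c swapped∈V ∣h∣≤1 1≤d d≤c
  where swapped∈V = InV-transfer m h c d h d c (markoff-swap m h c d) x∈V

1≤∣n-1∣ : ∀ {n} → 2 ℕ.≤ n → 1 ℕ.≤ ∣ + n - 1ℤ ∣
1≤∣n-1∣ (ℕ.s≤s (ℕ.s≤s _)) = ℕ.s≤s ℕ.z≤n

1≤∣m*n-1∣ : ∀ {m n} → 1 ℕ.≤ m → 2 ℕ.≤ n → 1 ℕ.≤ ∣ + m * + n - 1ℤ ∣
1≤∣m*n-1∣ {m} {n} 1≤m 2≤n =
  subst (λ t → 1 ℕ.≤ ∣ t - 1ℤ ∣) (ℤₚ.pos-* m n) (1≤∣n-1∣ (ℕₚ.*-mono-≤ 1≤m 2≤n))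

module _ (k : ℤ) (m : ℕ) (x : Vec ℤ (3 ℕ.+ m)) (a b : ℤ) where

  CaseI : Vec ℤ (3 ℕ.+ m) → Set
  CaseI y = (a ≡ b) × DescendentOf y x × InT' 0 k y × (y ∼ vieta (fromℕ (suc (suc m))) x)
            × ((i : Fin (3 ℕ.+ m)) → DescendentOf y (vieta i x))

  CaseII : Vec ℤ (3 ℕ.+ m) → Set
  CaseII y = (a < b) × DescendentOf y x × (∃ λ z → (y ∼ z) × InT' 1 k z)
             × (y ∼ vieta (fromℕ (suc (suc m))) x)
             × ((i : Fin (3 ℕ.+ m)) → DescendentOf y (vieta i x))

  caseI⇒¬caseII : ∀ {y y′} → CaseI y → ¬ CaseII y′
  caseI⇒¬caseII (a≡b , _) (a<b , _) = ℤₚ.<-irrefl a≡b a<b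

  y₀ y₁ : Vec ℤ (3 ℕ.+ m)
  y₀ = + 0 ∷ onesThen m (+ 1) a
  y₁ = - (+ 1) ∷ onesThen m (b - a) a

  Conclusion : Set
  Conclusion = (CaseI y₀ × ¬ CaseII y₁) ⊎ (CaseII y₁ × ¬ CaseI y₀)

  conclusion-caseI : CaseI y₀ → Conclusion
  conclusion-caseI caseI = inj₁ (caseI , caseI⇒¬caseII caseI)

  conclusion-caseII : CaseII y₁ → Conclusion
  conclusion-caseII caseII = inj₂ (caseII , λ caseI → caseI⇒¬caseII caseI caseII)

zero-head-step : ∀ m a {z} → Chain (a ∷ onesThen m 1ℤ a) z → Chain (0ℤ ∷ onesThen m 1ℤ a) z
zero-head-step m a =
  vieta-step m zero (trans (vieta-head m 0ℤ 1ℤ a) (cong (λ t → t ∷ onesThen m 1ℤ a) 1*a-0≡a))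
             ℕ.z≤n ℕₚ.≤-refl ℕₚ.≤-refl
  where
  1*a-0≡a : 1ℤ * a - 0ℤ ≡ a
  1*a-0≡a = trans (ℤₚ.+-identityʳ (1ℤ * a)) (ℤₚ.*-identityˡ a)

caseI-from-head : ∀ m A → 1 ℕ.≤ A →
  DescendentOf (0ℤ ∷ onesThen m 1ℤ (+ A)) (vieta zero (1ℤ ∷ onesThen m (+ A) (+ A)))
caseI-from-head m 1 _ = _ , done _ , ≡⇒∼ (vieta-head m 1ℤ 1ℤ 1ℤ)
caseI-from-head m A@(suc (suc _)) 1≤A =
  _ ,
  zero-head-step m a (vieta-step m (suc penultimate) (vieta-penultimate m a 1ℤ a)
                                 ℕₚ.≤-refl (1≤∣m*n-1∣ 1≤A (ℕ.s≤s (ℕ.s≤s ℕ.z≤n))) ℕₚ.≤-refl (done _)) ,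
  (≡⇒∼ (vieta-head m 1ℤ a a) ◅◅ swap-head-penultimate m (a * a - 1ℤ) a a ◅ ε)
  where
  a = + A

module CaseIProof (m A : ℕ) (1≤A : 1 ℕ.≤ A) where

  a : ℤ
  a = + A

  x y : Vec ℤ (3 ℕ.+ m)
  x = 1ℤ ∷ onesThen m a a
  y = 0ℤ ∷ onesThen m 1ℤ a

  private
    1*a-a≡0 : 1ℤ * a - a ≡ 0ℤ
    1*a-a≡0 = trans (cong (λ t → t - a) (ℤₚ.*-identityˡ a)) (ℤₚ.+-inverseʳ a)

    -- Unfolded, because the ring solver does not look inside markoff.
    markoff-identity : ∀ M a → 1ℤ * 1ℤ + (M + (a * a + a * a)) - 1ℤ * (a * a)
                             ≡ 0ℤ * 0ℤ + (M + (1ℤ * 1ℤ + a * a)) - 0ℤ * (1ℤ * a)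
    markoff-identity = solve-∀

  y∈V : ∀ {k} → InV k x → InV k y
  y∈V = InV-transfer m 1ℤ a a 0ℤ 1ℤ a (markoff-identity (+ m) a)

  vietaₚx≡ : vieta (suc penultimate) x ≡ 1ℤ ∷ onesThen m 0ℤ a
  vietaₚx≡ = trans (vieta-penultimate m 1ℤ a a) (cong (λ t → 1ℤ ∷ onesThen m t a) 1*a-a≡0)

  vietaᵤx≡ : vieta (suc ultimate) x ≡ 1ℤ ∷ onesThen m a 0ℤ
  vietaᵤx≡ = trans (vieta-ultimate m 1ℤ a a) (cong (λ t → 1ℤ ∷ onesThen m a t) 1*a-a≡0)

  caseI : ∀ {k} → InV k x → CaseI k m x a a y
  caseI x∈V =
    refl ,
    (_ , zero-head-step m a (done _) , swap-head-penultimate m 1ℤ a a ◅ ε) ,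
    ∷onesThen∈T′ m 0ℤ 1ℤ a (y∈V x∈V) ℕ.z≤n ℤₚ.≤-refl (+≤+ 1≤A) ,
    (swap-head-penultimate m 0ℤ 1ℤ a ◅ swap-penultimate-ultimate m 1ℤ 0ℤ a ◅ ≡⇒∼ (sym vietaᵤx≡)) ,
    descendent-of-vietas a a (caseI-from-head m A 1≤A)
      (y , done y , (≡⇒∼ vietaₚx≡ ◅◅ swap-head-penultimate m 1ℤ 0ℤ a ◅ ε))
      (y , done y , (≡⇒∼ vietaᵤx≡ ◅◅ swap-penultimate-ultimate m 1ℤ a 0ℤ ◅
                     swap-head-penultimate m 1ℤ 0ℤ a ◅ ε))

module CaseIIProof (m A D : ℕ) (1≤A : 1 ℕ.≤ A) (1≤D : 1 ℕ.≤ D) where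

  a d b : ℤ
  a = + A
  d = + D
  b = a + d

  x y : Vec ℤ (3 ℕ.+ m)
  x = 1ℤ ∷ onesThen m a b
  y = -1ℤ ∷ onesThen m d a

  private
    -1*a-d≡-b : ∀ a d → -1ℤ * a - d ≡ - (a + d)
    -1*a-d≡-b = solve-∀
    -1*d-a≡-b : ∀ a d → -1ℤ * d - a ≡ - (a + d)
    -1*d-a≡-b = solve-∀
    1*b-a≡d : ∀ a d → 1ℤ * (a + d) - a ≡ d
    1*b-a≡d = solve-∀
    1*a-b≡-d : ∀ a d → 1ℤ * a - (a + d) ≡ - d
    1*a-b≡-d = solve-∀
    -b*a+1≡-[a*b-1] : ∀ a d → - (a + d) * a - -1ℤ ≡ - (a * (a + d) - 1ℤ)
    -b*a+1≡-[a*b-1] = solve-∀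
    markoff-identity : ∀ M a d → 1ℤ * 1ℤ + (M + (a * a + (a + d) * (a + d))) - 1ℤ * (a * (a + d))
                               ≡ -1ℤ * -1ℤ + (M + (d * d + a * a)) - -1ℤ * (d * a)
    markoff-identity = solve-∀

    ∣-b∣≡b : ∣ - b ∣ ≡ A ℕ.+ D
    ∣-b∣≡b = ℤₚ.∣-i∣≡∣i∣ b

  y∈V : ∀ {k} → InV k x → InV k y
  y∈V = InV-transfer m 1ℤ a b -1ℤ d a (markoff-identity (+ m) a d)

  y⟶z : ∀ {w} → Chain (-1ℤ ∷ onesThen m (- b) a) w → Chain y w
  y⟶z = vieta-step m (suc penultimate)
          (trans (vieta-penultimate m -1ℤ d a) (cong (λ t → -1ℤ ∷ onesThen m t a) (-1*a-d≡-b a d)))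
          ℕₚ.≤-refl (subst (D ℕ.≤_) (sym ∣-b∣≡b) (ℕₚ.m≤n+m D A)) ℕₚ.≤-refl

  vietaₚx≡ : vieta (suc penultimate) x ≡ 1ℤ ∷ onesThen m d b
  vietaₚx≡ = trans (vieta-penultimate m 1ℤ a b) (cong (λ t → 1ℤ ∷ onesThen m t b) (1*b-a≡d a d))

  vietaᵤx≡ : vieta (suc ultimate) x ≡ 1ℤ ∷ onesThen m a (- d)
  vietaᵤx≡ = trans (vieta-ultimate m 1ℤ a b) (cong (λ t → 1ℤ ∷ onesThen m a t) (1*a-b≡-d a d))

  from-head : DescendentOf y (vieta zero x)
  from-head =
    _ ,
    y⟶z (vieta-step m zero
           (trans (vieta-head m -1ℤ (- b) a)
                  (cong (λ t → t ∷ onesThen m (- b) a) (-b*a+1≡-[a*b-1] a d)))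
           1≤∣-[a*b-1]∣ ℕₚ.≤-refl ℕₚ.≤-refl (done _)) ,
    (≡⇒∼ (vieta-head m 1ℤ a b) ◅◅ swap-penultimate-ultimate m (a * b - 1ℤ) a b ◅
     negate-head-penultimate m (a * b - 1ℤ) b a ◅ ε)
    where
    1≤∣-[a*b-1]∣ : 1 ℕ.≤ ∣ - (a * b - 1ℤ) ∣
    1≤∣-[a*b-1]∣ = subst (1 ℕ.≤_) (sym (ℤₚ.∣-i∣≡∣i∣ (a * b - 1ℤ)))
                         (1≤∣m*n-1∣ 1≤A (ℕₚ.+-mono-≤ 1≤A 1≤D))

  from-penultimate : DescendentOf y (vieta (suc penultimate) x)
  from-penultimate =
    _ ,
    vieta-step m (suc ultimate)
      (trans (vieta-ultimate m -1ℤ d a) (cong (λ t → -1ℤ ∷ onesThen m d t) (-1*d-a≡-b a d)))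
      ℕₚ.≤-refl ℕₚ.≤-refl (subst (A ℕ.≤_) (sym ∣-b∣≡b) (ℕₚ.m≤m+n A D)) (done _) ,
    (≡⇒∼ vietaₚx≡ ◅◅ negate-head-ultimate m 1ℤ d b ◅ ε)

  from-ultimate : DescendentOf y (vieta (suc ultimate) x)
  from-ultimate =
    y , done y , (≡⇒∼ vietaᵤx≡ ◅◅ negate-twice ◅ swap-penultimate-ultimate m -1ℤ a d ◅ ε)
    where
    negate-twice : Step (1ℤ ∷ onesThen m a (- d)) (-1ℤ ∷ onesThen m a d)
    negate-twice = subst (λ t → Step (1ℤ ∷ onesThen m a (- d)) (-1ℤ ∷ onesThen m a t))
                         (ℤₚ.neg-involutive d) (negate-head-ultimate m 1ℤ a (- d))

  caseII : ∀ {k} → InV k x → CaseII k m x a b y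
  caseII x∈V =
    +<+ (ℕₚ.m<m+n A 1≤D) ,
    (_ , y⟶z (done _) , swap-penultimate-ultimate m 1ℤ a b ◅ negate-head-penultimate m 1ℤ b a ◅ ε) ,
    sort-∷onesThen m -1ℤ d a (y∈V x∈V) ℕₚ.≤-refl (+≤+ 1≤D) (+≤+ 1≤A) ,
    (swap-penultimate-ultimate m -1ℤ d a ◅ negate-head-ultimate m -1ℤ a d ◅ ≡⇒∼ (sym vietaᵤx≡)) ,
    descendent-of-vietas a b from-head from-penultimate from-ultimate

dichotomy : ∀ k m {a b} → 1ℤ ≤ a → a ≤ b → InV k (1ℤ ∷ onesThen m a b) →
            Conclusion k m (1ℤ ∷ onesThen m a b) a b
dichotomy k m (+≤+ {n = A} 1≤A) (+≤+ {n = B} A≤B) x∈V with A ℕₚ.≟ B | ℕₚ.m≤n⇒∃[o]m+o≡n A≤B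
... | yes refl | _            = conclusion-caseI k m x a a (caseI x∈V)
  where open CaseIProof m A 1≤A
... | no A≢B   | 0 , refl     = contradiction (sym (ℕₚ.+-identityʳ A)) A≢B
... | no _     | suc D , refl =
  conclusion-caseII k m x a b (subst (λ t → CaseII k m x a b (-1ℤ ∷ onesThen m t a)) b-a≡d (caseII x∈V))
  where
  open CaseIIProof m A (suc D) 1≤A (ℕ.s≤s ℕ.z≤n)
  b-a≡d : d ≡ b - a
  b-a≡d = sym (identity a d)
    where identity : ∀ a d → a + d - a ≡ d
          identity = solve-∀

lemma2p2 : (k : ℤ) (m : ℕ) (x : Vec ℤ (3 Data.Nat.+ m)) →
    InT' 1 k x → lookup x zero ≡ + 1 →
    let a = lookup x (inject₁ (fromℕ (suc m)))
        b = lookup x (fromℕ (suc (suc m)))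
        y₀ = + 0 ∷ onesThen m (+ 1) a
        y₁ = - (+ 1) ∷ onesThen m (b - a) a
        CaseI = (a ≡ b) × DescendentOf y₀ x × InT' 0 k y₀ × (y₀ ∼ vieta (fromℕ (suc (suc m))) x)
                  × ((i : Fin (3 Data.Nat.+ m)) → DescendentOf y₀ (vieta i x))
        CaseII = (a < b) × DescendentOf y₁ x × (∃ λ z → (y₁ ∼ z) × InT' 1 k z)
                  × (y₁ ∼ vieta (fromℕ (suc (suc m))) x)
                  × ((i : Fin (3 Data.Nat.+ m)) → DescendentOf y₁ (vieta i x))
    in (CaseI × ¬ CaseII) ⊎ (CaseII × ¬ CaseI)
lemma2p2 k m (_ ∷ w) (x∈V , x↑ , ∣x₁⋯xₙ₋₂∣≡1) refl =
  subst (λ v → Conclusion k m (1ℤ ∷ v) a b) (sym w≡)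
        (dichotomy k m (x↑ zero (suc penultimate) ℕ.z≤n)
                       (x↑ (suc penultimate) (suc ultimate) (ℕ.s≤s penultimate≤ultimate))
                       (subst (λ v → InV k (1ℤ ∷ v)) w≡ x∈V))
  where
  a = lookup w penultimate
  b = lookup w ultimate
  w≡ : w ≡ onesThen m a b
  w≡ = unitPrefix⇒≡onesThen m w (λ i → x↑ zero (suc i) ℕ.z≤n)
         (trans (cong ∣_∣ (sym (ℤₚ.*-identityˡ (prodPrefix m w)))) ∣x₁⋯xₙ₋₂∣≡1)
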